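{- Let $\gamma$ be a countable ordinal. If $(T,r,c)$ is a $\gamma$-ranked coloring tree, then $\mathrm{rk}_T(u,h)\le r(u,h)$ for every $(u,h)\in\mathrm{app}(T)$. Conversely, if $T$ is a basic coloring tree with $\mathrm{rk}(T)\le\gamma$, then there exist $r,c$ such that $(T,r,c)$ is a $\gamma$-ranked coloring tree.
   Context: A basic coloring tree is a set $T$ of triples $(x,y,k)$, $x\ne y\in\omega^n$ for some $n$, $k\in\omega$, with: $(x,y,k)\in T\Rightarrow(y,x,k)\in T$; writing $\mathrm{Lev}_n(T)$ for the triples with $x,y\in\omega^n$, every $(x,y,k)\in\mathrm{Lev}_n(T)$ has, for each $m>n$ below the height of $T$, an extension $(x',y',k)\in\mathrm{Lev}_m(T)$ with $x\subseteq x'$, $y\subseteq y'$; each level uses finitely many $k$; and $\mathrm{suppt}(T)=\{x:(\exists(x',y,k)\in T)\,x\subseteq x'\}$ is finitely branching. An $n$-approximation of $T$ is $(u,h)$ with $u\subseteq\omega^n$ finite, $|u|\ge2$, $h\colon[u]^2\to\omega$, $(x,y,h(\{x,y\}))\in T$ for all $\{x,y\}\in[u]^2$; $\mathrm{app}(T)$ is the set of all approximations. For finite $x\subseteq\omega^n$, $y\subseteq\omega^m$, $x\triangleleft y$ means $n<m$ and $x=\{t\restriction n:t\in y\}$. $(u,h)<(u',h')$ iff $u\triangleleft u'$ and $h(\{x,y\})=h'(\{x',y'\})$ whenever $x,y\in u$, $x',y'\in u'$, $x\subseteq x'$, $y\subseteq y'$, $x\neq y$. A point $p\in u$ splits in $(u',h')$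 if it has at least two extensions in $u'$. $\mathrm{rk}_T(u,h)\in\mathrm{Ord}\cup\{\infty\}$: always $\ge0$; $\ge\beta$ for limit $\beta$ iff $\ge\alpha$ for all $\alpha<\beta$; $\ge\alpha+1$ iff for each $p\in u$ there is $(u',h')>(u,h)$ in $\mathrm{app}(T)$ with $\mathrm{rk}_T(u',h')\ge\alpha$ in which $p$ splits; $=\infty$ iff $\ge$ every ordinal. $\mathrm{rk}(T)=\sup\{\mathrm{rk}_T(u,h)+1:(u,h)\in\mathrm{app}(T)\}$. A $\gamma$-ranked coloring tree is a triple $(T,r,c)$ with $T$ a basic coloring tree, $r$ a function on $\mathrm{app}(T)$ with values ordinals $<\gamma$, $c$ a function on $\mathrm{app}(T)$ with $c(u,h)\in u$, such that: (U1) if $(u,h)<(u',h')$ then $r(u,h)\ge r(u',h')$, and if moreover $c(u,h)$ splits in $(u',h')$ then $r(u,h)>r(u',h')$; (U2) if $(u,h)<(u',h')$, $r(u,h)=r(u',h')$ and $|u|=|u'|$, then $c(u',h')$ extends $c(u,h)$; (U3) if $w\subseteq u$, $|w|\ge2$, and $g=h\restriction[w]^2$, then $r(w,g)\ge r(u,h)$. -}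

module Defs where

open import Data.Nat using (ℕ; zero; suc; _+_) renaming (_≤_ to _≤ℕ_; _<_ to _<ℕ_)
open import Data.Vec using (Vec; []; _∷_; _∷ʳ_)
open import Data.List using (List; length)
open import Data.List.Membership.Propositional using (_∈_)
open import Data.List.Relation.Unary.Unique.Propositional using (Unique)
open import Data.Product using (Σ; _×_; _,_; ∃; proj₁; proj₂)
open import Data.Empty using (⊥)
open import Data.Unit using (⊤)
open import Relation.Binary.PropositionalEquality using (_≡_; _≢_)
open import Relation.Nullary using (¬_)

-- Countable ordinals as Brouwer trees, with their (semantic) order.

data Ord : Set where
  oz : Ord
  os : Ord → Ord
  ol : (ℕ → Ord) → Ord

mutual
  _≤o_ : Ord → Ord → Set
  oz ≤o β = ⊤
  os α ≤o β = α <o β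
  ol f ≤o β = ∀ n → f n ≤o β

  _<o_ : Ord → Ord → Set
  α <o oz = ⊥
  α <o os β = α ≤o β
  α <o ol f = Σ ℕ λ n → α <o f n

Seq : ℕ → Set
Seq n = Vec ℕ n

-- x ⊑ y : x is an initial segment of y (x ⊆ y as functions)
data _⊑_ : ∀ {n m} → Seq n → Seq m → Set where
  []⊑ : ∀ {m} {y : Seq m} → [] ⊑ y
  ∷⊑ : ∀ {n m} {a} {x : Seq n} {y : Seq m} → x ⊑ y → (a ∷ x) ⊑ (a ∷ y)

Triples : Set₁
Triples = (n : ℕ) → Seq n → Seq n → ℕ → Set

BelowHeight : Triples → ℕ → Set
BelowHeight T m =
  Σ ℕ λ n → m ≤ℕ n × Σ (Seq n) λ x → Σ (Seq n) λ y → Σ ℕ λ k → T n x y k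

Suppt : Triples → ∀ {n} → Seq n → Set
Suppt T {n} x =
  Σ ℕ λ m → Σ (Seq m) λ x' → Σ (Seq m) λ y → Σ ℕ λ k → T m x' y k × x ⊑ x'

record BasicColoringTree (T : Triples) : Set where
  field
    distinct : ∀ {n} {x y : Seq n} {k} → T n x y k → x ≢ y
    symm     : ∀ {n} {x y : Seq n} {k} → T n x y k → T n y x k
    extend   : ∀ {n} {x y : Seq n} {k} → T n x y k →
               ∀ m → n <ℕ m → BelowHeight T m →
               Σ (Seq m) λ x' → Σ (Seq m) λ y' → x ⊑ x' × y ⊑ y' × T m x' y' k
    finColours : ∀ n → Σ (List ℕ) λ L → ∀ {x y : Seq n} {k} → T n x y k → k ∈ L
    finBranch : ∀ {n} (x : Seq n) → Suppt T x →
                Σ (List ℕ) λ L → ∀ i → Suppt T (x ∷ʳ i) → i ∈ L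

-- n-approximations (u , h): u a finite subset of ω^n (a duplicate-free
-- list), |u| ≥ 2, h a colouring of the unordered pairs of u (given by a
-- function symmetric on u).

record App (T : Triples) (n : ℕ) : Set where
  field
    pts    : List (Seq n)
    uniq   : Unique pts
    two    : 2 ≤ℕ length pts
    col    : Seq n → Seq n → ℕ
    colSym : ∀ {x y} → x ∈ pts → y ∈ pts → col x y ≡ col y x
    inT    : ∀ {x y} → x ∈ pts → y ∈ pts → x ≢ y → T n x y (col x y)
open App public

Approx : Triples → Set
Approx T = Σ ℕ (App T)

lvl : ∀ {T} → Approx T → ℕ
lvl = proj₁

_◁_ : ∀ {n m} → List (Seq n) → List (Seq m) → Set
_◁_ {n} {m} u v =
  n <ℕ m × (∀ {t} → t ∈ v → Σ (Seq n) λ s → s ∈ u × s ⊑ t)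
         × (∀ {s} → s ∈ u → Σ (Seq m) λ t → t ∈ v × s ⊑ t)

_≺_ : ∀ {T} → Approx T → Approx T → Set
(n , a) ≺ (m , b) =
  pts a ◁ pts b ×
  (∀ {x y : Seq n} {x' y' : Seq m} → x ∈ pts a → y ∈ pts a → x' ∈ pts b → y' ∈ pts b →
     x ⊑ x' → y ⊑ y' → x ≢ y → col a x y ≡ col b x' y')

Splits : ∀ {T n} → Seq n → Approx T → Set
Splits p (m , b) =
  Σ (Seq m) λ t₁ → Σ (Seq m) λ t₂ → t₁ ∈ pts b × t₂ ∈ pts b × t₁ ≢ t₂ × p ⊑ t₁ × p ⊑ t₂

RkGe : (T : Triples) → Approx T → Ord → Set
RkGe T a oz = ⊤
RkGe T a (os α) =
  ∀ {p} → p ∈ pts (proj₂ a) → Σ (Approx T) λ a' → a ≺ a' × RkGe T a' α × Splits p a'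
RkGe T a (ol f) = ∀ n → RkGe T a (f n)

RkLe : (T : Triples) → Approx T → Ord → Set
RkLe T a β = ¬ RkGe T a (os β)

-- rk(T) ≤ γ  (i.e. rk_T(u , h) < γ for every (u , h) ∈ app(T))
TreeRkLe : Triples → Ord → Set
TreeRkLe T γ = ∀ a → ¬ RkGe T a γ

record IsRanked (γ : Ord) (T : Triples)
                (r : Approx T → Ord) (c : (a : Approx T) → Seq (lvl a)) : Set where
  field
    basic : BasicColoringTree T
    rBound : ∀ a → r a <o γ
    cIn    : ∀ a → c a ∈ pts (proj₂ a)
    U1a    : ∀ {a a'} → a ≺ a' → r a' ≤o r a
    U1b    : ∀ {a a'} → a ≺ a' → Splits (c a) a' → r a' <o r a
    U2     : ∀ {a a'} → a ≺ a' → (r a ≤o r a' × r a' ≤o r a) →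
             length (pts (proj₂ a)) ≡ length (pts (proj₂ a')) → c a ⊑ c a'
    U3     : ∀ {n} (w u : App T n) →
             (∀ {x} → x ∈ pts w → x ∈ pts u) →
             (∀ {x y} → x ∈ pts w → y ∈ pts w → x ≢ y → col w x y ≡ col u x y) →
             r (n , u) ≤o r (n , w)

{-# OPTIONS --safe #-}
module Submission where

-- If rk(u,h) ≥ α + 1, the point c(u,h) splits in an extension of rank ≥ α, whose r-value is
-- smaller than r(u,h) by (U1); so rk ≥ α implies α ≤ r by induction on α.
--
-- Conversely, excluded middle lets us take r = rk, which is below γ; (U1a) and (U3) hold because
-- rk can only decrease along extensions and increase under restriction. Call a node q a candidate
-- for (u,h) if it is a point of some approximation (w,g) ≤ (u,h) (equality allowed) and does not
-- split in any extension of (w,g) of rank ≥ rk(u,h). Since rk(u,h) ≱ rk(u,h) + 1, some point of u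
-- is a candidate, and a candidate has exactly one extension in u: let c(u,h) be the extension of
-- the shortlex-least candidate. This c(u,h) cannot split in an extension of rank ≥ rk(u,h), which
-- gives (U1b). If (u,h) < (u',h') have the same rank, they have the same candidates up to the
-- level of u, hence the same least candidate; this gives (U2), even without |u| = |u'|.

open import Defs
open import Data.List using (List; _∷_; length; filter)
open import Data.List.Membership.Propositional using (_∈_)
open import Data.List.Membership.Propositional.Properties using (∈-filter⁺; ∈-filter⁻; ∈-length)
open import Data.List.Relation.Unary.Any using (here; there)
open import Data.List.Relation.Unary.Unique.Propositional.Properties using (filter⁺)
open import Data.Nat using (ℕ; zero; suc; z≤n; s≤s) renaming (_≤_ to _≤ℕ_; _<_ to _<ℕ_)
open import Data.Nat.Induction using (<-wellFounded)
open import Data.Nat.Properties using (≤-refl; ≤-trans; <⇒≤; ≤-<-trans; <-irrefl; <-asym; ≮⇒≥; m≤n⇒m<n∨m≡n)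
open import Data.Product using (Σ; _×_; _,_; proj₁; proj₂)
open import Data.Sum using (_⊎_; inj₁; inj₂)
open import Data.Unit using (⊤; tt)
open import Data.Vec using ([]; _∷_)
open import Function using (_∘_)
open import Induction.WellFounded using (Acc; acc)
open import Relation.Binary.PropositionalEquality using (_≡_; _≢_; refl; sym; trans; cong; cong₂; subst)
open import Relation.Nullary using (¬_; Dec; yes; no; contradiction)
open import Relation.Nullary.Decidable using (decidable-stable)

≤o-ol : ∀ α f n → α ≤o f n → α ≤o ol f
≤o-ol oz     f n _      = tt
≤o-ol (os α) f n α<fn   = n , α<fn
≤o-ol (ol g) f n g≤fn   = λ k → ≤o-ol (g k) f n (g≤fn k)

≤o-refl : ∀ α → α ≤o α
≤o-refl oz     = tt
≤o-refl (os α) = ≤o-refl α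
≤o-refl (ol f) = λ n → ≤o-ol (f n) f n (≤o-refl (f n))

mutual
  <o⇒≤o : ∀ α β → α <o β → α ≤o β
  <o⇒≤o α oz     ()
  <o⇒≤o α (os β) α≤β       = ≤o-os α β α≤β
  <o⇒≤o α (ol f) (n , α<fn) = ≤o-ol α f n (<o⇒≤o α (f n) α<fn)

  ≤o-os : ∀ α β → α ≤o β → α ≤o os β
  ≤o-os oz     β _    = tt
  ≤o-os (os α) β α<β  = <o⇒≤o α β α<β
  ≤o-os (ol g) β g≤β  = λ k → ≤o-os (g k) β (g≤β k)

mutual
  ≤o-<o-trans : ∀ α β γ → α ≤o β → β <o γ → α <o γ
  ≤o-<o-trans α β oz     _   ()
  ≤o-<o-trans α β (os γ) α≤β β≤γ       = ≤o-trans α β γ α≤β β≤γ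
  ≤o-<o-trans α β (ol h) α≤β (n , β<hn) = n , ≤o-<o-trans α β (h n) α≤β β<hn

  ≤o-trans : ∀ α β γ → α ≤o β → β ≤o γ → α ≤o γ
  ≤o-trans oz     β γ _   _   = tt
  ≤o-trans (os α) β γ α<β β≤γ = <o-≤o-trans α β γ α<β β≤γ
  ≤o-trans (ol f) β γ f≤β β≤γ = λ n → ≤o-trans (f n) β γ (f≤β n) β≤γ

  <o-≤o-trans : ∀ α β γ → α <o β → β ≤o γ → α <o γ
  <o-≤o-trans α oz     γ ()
  <o-≤o-trans α (os β) γ α≤β      β<γ = ≤o-<o-trans α β γ α≤β β<γ
  <o-≤o-trans α (ol g) γ (n , α<gn) g≤γ = <o-≤o-trans α (g n) γ α<gn (g≤γ n)

<o-irrefl : ∀ α → ¬ α <o α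
<o-irrefl oz     ()
<o-irrefl (os α) α<α = <o-irrefl α α<α
<o-irrefl (ol f) (n , ol<fn) =
  <o-irrefl (f n) (≤o-<o-trans (f n) (ol f) (f n) (≤o-ol (f n) f n (≤o-refl (f n))) ol<fn)

⊑-refl : ∀ {n} (x : Seq n) → x ⊑ x
⊑-refl []      = []⊑
⊑-refl (_ ∷ x) = ∷⊑ (⊑-refl x)

⊑-trans : ∀ {n m k} {x : Seq n} {y : Seq m} {z : Seq k} → x ⊑ y → y ⊑ z → x ⊑ z
⊑-trans []⊑     _       = []⊑
⊑-trans (∷⊑ p) (∷⊑ q) = ∷⊑ (⊑-trans p q)

⊑-length : ∀ {n m} {x : Seq n} {y : Seq m} → x ⊑ y → n ≤ℕ m
⊑-length []⊑     = z≤n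
⊑-length (∷⊑ p) = s≤s (⊑-length p)

⊑-linear : ∀ {n m k} {x : Seq n} {y : Seq m} {z : Seq k} → x ⊑ z → y ⊑ z → n ≤ℕ m → x ⊑ y
⊑-linear []⊑     _       _         = []⊑
⊑-linear (∷⊑ p) (∷⊑ q) (s≤s n≤m) = ∷⊑ (⊑-linear p q n≤m)

⊑⇒≡ : ∀ {n} {x y : Seq n} → x ⊑ y → x ≡ y
⊑⇒≡ {y = []} []⊑  = refl
⊑⇒≡ (∷⊑ p)       = cong (_ ∷_) (⊑⇒≡ p)

≢-⊑ : ∀ {m n} {x y : Seq m} {x' y' : Seq n} → x ⊑ x' → y ⊑ y' → x ≢ y → x' ≢ y'
≢-⊑ x⊑x' y⊑y' x≢y refl = x≢y (⊑⇒≡ (⊑-linear x⊑x' y⊑y' ≤-refl))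

∃-member : ∀ {X : Set} {n} (xs : List X) → suc n ≤ℕ length xs → Σ X (_∈ xs)
∃-member (x ∷ _) _ = x , here refl

two-members⇒2≤length : ∀ {X : Set} {x y : X} {xs : List X} →
                       x ∈ xs → y ∈ xs → x ≢ y → 2 ≤ℕ length xs
two-members⇒2≤length (here refl) (here refl) x≢y = contradiction refl x≢y
two-members⇒2≤length (here refl) (there y∈)  _   = s≤s (∈-length y∈)
two-members⇒2≤length (there x∈)  _           _   = s≤s (∈-length x∈)

_≤lex_ : ∀ {m} → Seq m → Seq m → Set
[]      ≤lex []      = ⊤
(x ∷ v) ≤lex (y ∷ w) = x <ℕ y ⊎ (x ≡ y × v ≤lex w)

≤lex-antisym : ∀ {m} {v w : Seq m} → v ≤lex w → w ≤lex v → v ≡ w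
≤lex-antisym {v = []}    {[]}    _ _ = refl
≤lex-antisym {v = _ ∷ _} {_ ∷ _} (inj₁ x<y)        (inj₁ y<x)        = contradiction y<x (<-asym x<y)
≤lex-antisym {v = _ ∷ _} {_ ∷ _} (inj₁ x<x)        (inj₂ (refl , _)) = contradiction x<x (<-irrefl refl)
≤lex-antisym {v = _ ∷ _} {_ ∷ _} (inj₂ (refl , _)) (inj₁ x<x)        = contradiction x<x (<-irrefl refl)
≤lex-antisym {v = _ ∷ _} {_ ∷ _} (inj₂ (refl , v≤w)) (inj₂ (_ , w≤v)) = cong (_ ∷_) (≤lex-antisym v≤w w≤v)

Node : Set
Node = Σ ℕ Seq

data _≤shortlex_ : Node → Node → Set where
  shorter : ∀ {m k} {p : Seq m} {q : Seq k} → m <ℕ k → (m , p) ≤shortlex (k , q)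
  lex     : ∀ {m} {p q : Seq m} → p ≤lex q → (m , p) ≤shortlex (m , q)

≤shortlex⇒≤ : ∀ {x y} → x ≤shortlex y → proj₁ x ≤ℕ proj₁ y
≤shortlex⇒≤ (shorter m<k) = <⇒≤ m<k
≤shortlex⇒≤ (lex _)       = ≤-refl

≤shortlex-antisym : ∀ {x y} → x ≤shortlex y → y ≤shortlex x → x ≡ y
≤shortlex-antisym (shorter m<k) (shorter k<m) = contradiction k<m (<-asym m<k)
≤shortlex-antisym (shorter m<m) (lex _)       = contradiction m<m (<-irrefl refl)
≤shortlex-antisym (lex _)       (shorter m<m) = contradiction m<m (<-irrefl refl)
≤shortlex-antisym (lex p≤q)     (lex q≤p)     = cong (_ ,_) (≤lex-antisym p≤q q≤p)

module Classical (dec : (P : Set) → Dec P) where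

  ¬∀⇒∃¬ : ∀ {A : Set} (B : A → Set) → ¬ (∀ x → B x) → Σ A λ x → ¬ B x
  ¬∀⇒∃¬ B ¬∀B = decidable-stable (dec _) λ ∄¬B →
    ¬∀B λ x → decidable-stable (dec (B x)) λ ¬Bx → ∄¬B (x , ¬Bx)

  leastℕ : (P : ℕ → Set) → ∀ k → P k → Σ ℕ λ m → P m × (∀ j → P j → m ≤ℕ j)
  leastℕ P k = go k (<-wellFounded k)
    where
    go : ∀ k → Acc _<ℕ_ k → P k → Σ ℕ λ m → P m × (∀ j → P j → m ≤ℕ j)
    go k (acc below) Pk with dec (Σ ℕ λ j → j <ℕ k × P j)
    ... | yes (j , j<k , Pj) = go j (below j<k) Pj
    ... | no ∄               = k , Pk , λ j Pj → ≮⇒≥ λ j<k → ∄ (j , j<k , Pj)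

  lex-least : ∀ m (P : Seq m → Set) → Σ (Seq m) P →
              Σ (Seq m) λ v → P v × (∀ w → P w → v ≤lex w)
  lex-least zero    P ([] , P[]) = [] , P[] , λ { [] _ → tt }
  lex-least (suc m) P ((x ∷ w) , Pxw)
    with leastℕ (λ y → Σ (Seq m) λ w → P (y ∷ w)) x (w , Pxw)
  ... | x₀ , (w₁ , Pw₁) , x₀-least with lex-least m (λ w → P (x₀ ∷ w)) (w₁ , Pw₁)
  ... | w₀ , Pw₀ , w₀-least = (x₀ ∷ w₀) , Pw₀ , least
    where
    least : ∀ v → P v → (x₀ ∷ w₀) ≤lex v
    least (y ∷ w) Pyw with m≤n⇒m<n∨m≡n (x₀-least y (w , Pyw))
    ... | inj₁ x₀<y = inj₁ x₀<y
    ... | inj₂ refl = inj₂ (refl , w₀-least w Pyw)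

  shortlex-least : (P : Node → Set) → Σ Node P →
                   Σ Node λ x → P x × (∀ y → P y → x ≤shortlex y)
  shortlex-least P ((k , q) , Pq)
    with leastℕ (λ m → Σ (Seq m) λ p → P (m , p)) k (q , Pq)
  ... | m , (p₁ , Pp₁) , m-least with lex-least m (λ p → P (m , p)) (p₁ , Pp₁)
  ... | p , Pp , p-least = (m , p) , Pp , least
    where
    least : ∀ y → P y → (m , p) ≤shortlex y
    least (k , q) Pq with m≤n⇒m<n∨m≡n (m-least k (q , Pq))
    ... | inj₁ m<k = shorter m<k
    ... | inj₂ refl = lex (p-least q Pq)

module _ {T : Triples} where

  -- The order < on app(T) without the requirement that the level increase, hence reflexive.
  record _⊴_ {m n} (B : App T m) (A : App T n) : Set where
    field
      down : ∀ {t} → t ∈ pts A → Σ (Seq m) λ s → s ∈ pts B × s ⊑ t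
      up   : ∀ {s} → s ∈ pts B → Σ (Seq n) λ t → t ∈ pts A × s ⊑ t
      col≡ : ∀ {x y : Seq m} {x' y' : Seq n} → x ∈ pts B → y ∈ pts B → x' ∈ pts A → y' ∈ pts A →
             x ⊑ x' → y ⊑ y' → x ≢ y → col B x y ≡ col A x' y'
  open _⊴_ public

  ≺⇒⊴ : ∀ {m n} {B : App T m} {A : App T n} → (m , B) ≺ (n , A) → B ⊴ A
  ≺⇒⊴ ((_ , down , up) , col≡) = record { down = down ; up = up ; col≡ = col≡ }

  ⊴⇒≺ : ∀ {m n} {B : App T m} {A : App T n} → B ⊴ A → m <ℕ n → (m , B) ≺ (n , A)
  ⊴⇒≺ B⊴A m<n = (m<n , down B⊴A , up B⊴A) , col≡ B⊴A

  ⊴-refl : ∀ {n} (A : App T n) → A ⊴ A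
  ⊴-refl A = record
    { down = λ {t} t∈ → t , t∈ , ⊑-refl t
    ; up   = λ {s} s∈ → s , s∈ , ⊑-refl s
    ; col≡ = λ { _ _ _ _ x⊑x' y⊑y' _ → cong₂ (col A) (⊑⇒≡ x⊑x') (⊑⇒≡ y⊑y') }
    }

  ⊴-level : ∀ {m n} {B : App T m} {A : App T n} → B ⊴ A → m ≤ℕ n
  ⊴-level {B = B} B⊴A =
    let (_ , s∈) = ∃-member (pts B) (two B) ; (_ , _ , s⊑t) = up B⊴A s∈ in ⊑-length s⊑t

  ⊴-trans : ∀ {m n k} {C : App T m} {B : App T n} {A : App T k} → C ⊴ B → B ⊴ A → C ⊴ A
  ⊴-trans C⊴B B⊴A = record
    { down = λ t∈ →
        let (s , s∈ , s⊑t) = down B⊴A t∈ ; (s' , s'∈ , s'⊑s) = down C⊴B s∈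
        in s' , s'∈ , ⊑-trans s'⊑s s⊑t
    ; up = λ s∈ →
        let (t , t∈ , s⊑t) = up C⊴B s∈ ; (t' , t'∈ , t⊑t') = up B⊴A t∈
        in t' , t'∈ , ⊑-trans s⊑t t⊑t'
    ; col≡ = λ x∈ y∈ x''∈ y''∈ x⊑x'' y⊑y'' x≢y →
        let (x' , x'∈ , x'⊑x'') = down B⊴A x''∈ ; (y' , y'∈ , y'⊑y'') = down B⊴A y''∈
            x⊑x' = ⊑-linear x⊑x'' x'⊑x'' (⊴-level C⊴B)
            y⊑y' = ⊑-linear y⊑y'' y'⊑y'' (⊴-level C⊴B)
        in trans (col≡ C⊴B x∈ y∈ x'∈ y'∈ x⊑x' y⊑y' x≢y)
                 (col≡ B⊴A x'∈ y'∈ x''∈ y''∈ x'⊑x'' y'⊑y'' (≢-⊑ x⊑x' y⊑y' x≢y))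
    }

  ⊴-linear : ∀ {m n k} {C : App T m} {B : App T n} {A : App T k} →
             C ⊴ A → B ⊴ A → m ≤ℕ n → C ⊴ B
  ⊴-linear C⊴A B⊴A m≤n = record
    { down = λ t∈ →
        let (t' , t'∈ , t⊑t') = up B⊴A t∈ ; (s , s∈ , s⊑t') = down C⊴A t'∈
        in s , s∈ , ⊑-linear s⊑t' t⊑t' m≤n
    ; up = λ s∈ →
        let (t' , t'∈ , s⊑t') = up C⊴A s∈ ; (t , t∈ , t⊑t') = down B⊴A t'∈
        in t , t∈ , ⊑-linear s⊑t' t⊑t' m≤n
    ; col≡ = λ x∈ y∈ x'∈ y'∈ x⊑x' y⊑y' x≢y →
        let (x'' , x''∈ , x'⊑x'') = up B⊴A x'∈ ; (y'' , y''∈ , y'⊑y'') = up B⊴A y'∈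
        in trans (col≡ C⊴A x∈ y∈ x''∈ y''∈ (⊑-trans x⊑x' x'⊑x'') (⊑-trans y⊑y' y'⊑y'') x≢y)
                 (sym (col≡ B⊴A x'∈ y'∈ x''∈ y''∈ x'⊑x'' y'⊑y'' (≢-⊑ x⊑x' y⊑y' x≢y)))
    }

  ⊴-≺-trans : ∀ {m n} {C : App T m} {B : App T n} {a : Approx T} →
              C ⊴ B → (n , B) ≺ a → (m , C) ≺ a
  ⊴-≺-trans {a = _ , A} C⊴B B≺A =
    ⊴⇒≺ (⊴-trans C⊴B (≺⇒⊴ {A = A} B≺A)) (≤-<-trans (⊴-level C⊴B) (proj₁ (proj₁ B≺A)))

module _ {T : Triples} where

  SplitsAbove : (a : Approx T) → Ord → Seq (lvl a) → Set
  SplitsAbove a α p = Σ (Approx T) λ a' → a ≺ a' × RkGe T a' α × Splits p a'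

  mutual
    RkGe-≤o : ∀ α β a → α ≤o β → RkGe T a β → RkGe T a α
    RkGe-≤o oz     β a _   _    = tt
    RkGe-≤o (os α) β a α<β rk≥β = RkGe-<o α β a α<β rk≥β
    RkGe-≤o (ol f) β a f≤β rk≥β = λ n → RkGe-≤o (f n) β a (f≤β n) rk≥β

    RkGe-<o : ∀ α β a → α <o β → RkGe T a β → RkGe T a (os α)
    RkGe-<o α oz     a ()
    RkGe-<o α (os β) a α≤β        rk≥β+1 p∈ =
      let (a' , a≺a' , rk'≥β , split) = rk≥β+1 p∈ in a' , a≺a' , RkGe-≤o α β a' α≤β rk'≥β , split
    RkGe-<o α (ol g) a (n , α<gn) rk≥g = RkGe-<o α (g n) a α<gn (rk≥g n)

  RkGe-≺ : ∀ α {a a'} → a ≺ a' → RkGe T a' α → RkGe T a α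
  RkGe-≺ oz     _    _ = tt
  RkGe-≺ (os α) {_ , A} {_ , A'} A≺A' rk'≥α+1 p∈ =
    let A⊴A' = ≺⇒⊴ {B = A} {A'} A≺A'
        (t , t∈ , p⊑t) = up A⊴A' p∈
        (a'' , a'≺a'' , rk''≥α , (t₁ , t₂ , t₁∈ , t₂∈ , t₁≢t₂ , t⊑t₁ , t⊑t₂)) = rk'≥α+1 t∈
    in a'' , ⊴-≺-trans {a = a''} A⊴A' a'≺a'' , rk''≥α ,
       (t₁ , t₂ , t₁∈ , t₂∈ , t₁≢t₂ , ⊑-trans p⊑t t⊑t₁ , ⊑-trans p⊑t t⊑t₂)
  RkGe-≺ (ol f) a≺a' rk'≥f = λ n → RkGe-≺ (f n) a≺a' (rk'≥f n)

  _⊆ₐ_ : ∀ {n} → App T n → App T n → Set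
  w ⊆ₐ u = (∀ {x} → x ∈ pts w → x ∈ pts u) ×
           (∀ {x y} → x ∈ pts w → y ∈ pts w → x ≢ y → col w x y ≡ col u x y)

  filterApp : ∀ {m} (u : App T m) {P : Seq m → Set} (P? : ∀ t → Dec (P t)) →
              2 ≤ℕ length (filter P? (pts u)) → App T m
  filterApp u P? two' = record
    { pts    = filter P? (pts u)
    ; uniq   = filter⁺ P? (uniq u)
    ; two    = two'
    ; col    = col u
    ; colSym = λ x∈ y∈ → colSym u (∈-filter⇒∈ x∈) (∈-filter⇒∈ y∈)
    ; inT    = λ x∈ y∈ → inT u (∈-filter⇒∈ x∈) (∈-filter⇒∈ y∈)
    }
    where
    ∈-filter⇒∈ : ∀ {x} → x ∈ filter P? (pts u) → x ∈ pts u
    ∈-filter⇒∈ = proj₁ ∘ ∈-filter⁻ P?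

  filterApp-⊆ₐ : ∀ {m} (u : App T m) {P : Seq m → Set} (P? : ∀ t → Dec (P t))
                 (two' : 2 ≤ℕ length (filter P? (pts u))) → filterApp u P? two' ⊆ₐ u
  filterApp-⊆ₐ u P? _ = proj₁ ∘ ∈-filter⁻ P? , λ _ _ _ → refl

  ⊴-restrict : ∀ {n m} {w u : App T n} {u' : App T m} → w ⊆ₐ u → u ⊴ u' →
               (above-w? : ∀ t → Dec (Σ (Seq n) λ s → s ∈ pts w × s ⊑ t))
               (two' : 2 ≤ℕ length (filter above-w? (pts u'))) → w ⊴ filterApp u' above-w? two'
  ⊴-restrict {u' = u'} (w⊆u , col-w≡u) u⊴u' above-w? two' = record
    { down = proj₂ ∘ ∈-filter⁻ above-w? {xs = pts u'}
    ; up   = λ s∈ → let (t , t∈ , s⊑t) = up u⊴u' (w⊆u s∈)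
                    in t , ∈-filter⁺ above-w? t∈ (_ , s∈ , s⊑t) , s⊑t
    ; col≡ = λ x∈ y∈ x'∈ y'∈ x⊑x' y⊑y' x≢y →
        trans (col-w≡u x∈ y∈ x≢y)
              (col≡ u⊴u' (w⊆u x∈) (w⊆u y∈) (w'⊆u' x'∈) (w'⊆u' y'∈) x⊑x' y⊑y' x≢y)
    }
    where
    w'⊆u' = proj₁ (filterApp-⊆ₐ u' above-w? two')

module Rank (dec : (P : Set) → Dec P) {T : Triples} where
  open Classical dec

  RkLe⇒unsplit : ∀ β a → RkLe T a β → Σ (Seq (lvl a)) λ p → p ∈ pts (proj₂ a) × ¬ SplitsAbove a β p
  RkLe⇒unsplit β a rk≤β =
    let ((p , p∈) , unsplit) = ¬∀⇒∃¬ {A = Σ (Seq (lvl a)) (_∈ pts (proj₂ a))}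
                                     (λ (p , _) → SplitsAbove a β p)
                                     (λ split → rk≤β λ p∈ → split (_ , p∈))
    in p , p∈ , unsplit

  mutual
    RkGe∧¬RkGe⇒<o : ∀ α β a → RkGe T a α → ¬ RkGe T a β → α <o β
    RkGe∧¬RkGe⇒<o α oz     a _    rk≱0 = contradiction tt rk≱0
    RkGe∧¬RkGe⇒<o α (os β) a rk≥α rk≤β = RkGe∧RkLe⇒≤o α β a rk≥α rk≤β
    RkGe∧¬RkGe⇒<o α (ol g) a rk≥α rk≱g =
      let (n , rk≱gn) = ¬∀⇒∃¬ (λ n → RkGe T a (g n)) rk≱g
      in n , RkGe∧¬RkGe⇒<o α (g n) a rk≥α rk≱gn

    RkGe∧RkLe⇒≤o : ∀ α β a → RkGe T a α → RkLe T a β → α ≤o β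
    RkGe∧RkLe⇒≤o oz     β a _      _   = tt
    RkGe∧RkLe⇒≤o (os α) β a rk≥α+1 rk≤β =
      let (p , p∈ , unsplit) = RkLe⇒unsplit β a rk≤β
          (a' , a≺a' , rk'≥α , split) = rk≥α+1 p∈
      in RkGe∧¬RkGe⇒<o α β a' rk'≥α λ rk'≥β → unsplit (a' , a≺a' , rk'≥β , split)
    RkGe∧RkLe⇒≤o (ol f) β a rk≥f   rk≤β = λ n → RkGe∧RkLe⇒≤o (f n) β a (rk≥f n) rk≤β

  rank-below : ∀ a δ → ¬ RkGe T a δ → Σ Ord λ β → β <o δ × RkGe T a β × RkLe T a β
  rank-below a oz     rk≱0 = contradiction tt rk≱0
  rank-below a (os δ) rk≤δ with dec (RkGe T a δ)
  ... | yes rk≥δ = δ , ≤o-refl δ , rk≥δ , rk≤δ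
  ... | no  rk≱δ = let (β , β<δ , rk≥β , rk≤β) = rank-below a δ rk≱δ
                   in β , <o⇒≤o β δ β<δ , rk≥β , rk≤β
  rank-below a (ol f) rk≱f =
    let (n , rk≱fn) = ¬∀⇒∃¬ (λ n → RkGe T a (f n)) rk≱f
        (β , β<fn , rk≥β , rk≤β) = rank-below a (f n) rk≱fn
    in β , (n , β<fn) , rk≥β , rk≤β

  RkGe-⊆ₐ : ∀ α {n} (w u : App T n) → w ⊆ₐ u → RkGe T (n , u) α → RkGe T (n , w) α
  RkGe-⊆ₐ oz     w u _ _ = tt
  RkGe-⊆ₐ (os α) {n} w u w⊆u rk≥α+1 {p} p∈w with rk≥α+1 (proj₁ w⊆u p∈w)
  ... | (m , u') , u≺u' , rk'≥α , (t₁ , t₂ , t₁∈ , t₂∈ , t₁≢t₂ , p⊑t₁ , p⊑t₂) =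
    (m , w') , ⊴⇒≺ (⊴-restrict {w = w} {u} {u'} w⊆u (≺⇒⊴ u≺u') above-w? two') (proj₁ (proj₁ u≺u')) ,
    RkGe-⊆ₐ α w' u' (filterApp-⊆ₐ u' above-w? two') rk'≥α ,
    (t₁ , t₂ , ∈w' t₁∈ p⊑t₁ , ∈w' t₂∈ p⊑t₂ , t₁≢t₂ , p⊑t₁ , p⊑t₂)
    where
    above-w? : ∀ t → Dec (Σ (Seq n) λ s → s ∈ pts w × s ⊑ t)
    above-w? t = dec _
    ∈w' : ∀ {t} → t ∈ pts u' → p ⊑ t → t ∈ filter above-w? (pts u')
    ∈w' t∈ p⊑t = ∈-filter⁺ above-w? t∈ (p , p∈w , p⊑t)
    two' : 2 ≤ℕ length (filter above-w? (pts u'))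
    two' = two-members⇒2≤length (∈w' t₁∈ p⊑t₁) (∈w' t₂∈ p⊑t₂) t₁≢t₂
    w' : App T m
    w' = filterApp u' above-w? two'
  RkGe-⊆ₐ (ol f) w u w⊆u rk≥f = λ n → RkGe-⊆ₐ (f n) w u w⊆u (rk≥f n)

module RankBound {T : Triples} (r : Approx T → Ord) (c : (a : Approx T) → Seq (lvl a))
         (c∈ : ∀ a → c a ∈ pts (proj₂ a))
         (r-drops : ∀ {a a'} → a ≺ a' → Splits (c a) a' → r a' <o r a) where

  RkGe⇒≤r : ∀ α a → RkGe T a α → α ≤o r a
  RkGe⇒≤r oz     a _ = tt
  RkGe⇒≤r (os α) a rk≥α+1 with rk≥α+1 (c∈ a)
  ... | a' , a≺a' , rk'≥α , c-splits =
    ≤o-<o-trans α (r a') (r a) (RkGe⇒≤r α a' rk'≥α) (r-drops a≺a' c-splits)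
  RkGe⇒≤r (ol f) a rk≥f = λ n → RkGe⇒≤r (f n) a (rk≥f n)

  rk≤r : ∀ a → RkLe T a (r a)
  rk≤r a rk>r = <o-irrefl (r a) (RkGe⇒≤r (os (r a)) a rk>r)

module Construction (dec : (P : Set) → Dec P) {γ : Ord} {T : Triples} (rk<γ : TreeRkLe T γ) where
  open Classical dec
  open Rank dec

  rank : ∀ a → Σ Ord λ β → β <o γ × RkGe T a β × RkLe T a β
  rank a = rank-below a γ (rk<γ a)

  r : Approx T → Ord
  r a = proj₁ (rank a)

  r<γ : ∀ a → r a <o γ
  r<γ a = proj₁ (proj₂ (rank a))

  rk≥r : ∀ a → RkGe T a (r a)
  rk≥r a = proj₁ (proj₂ (proj₂ (rank a)))

  rk≤r : ∀ a → RkLe T a (r a)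
  rk≤r a = proj₂ (proj₂ (proj₂ (rank a)))

  r-antitone : ∀ {a a'} → a ≺ a' → r a' ≤o r a
  r-antitone {a} {a'} a≺a' = RkGe∧RkLe⇒≤o (r a') (r a) a (RkGe-≺ (r a') a≺a' (rk≥r a')) (rk≤r a)

  r-⊆ₐ : ∀ {n} (w u : App T n) → w ⊆ₐ u → r (n , u) ≤o r (n , w)
  r-⊆ₐ {n} w u w⊆u =
    RkGe∧RkLe⇒≤o (r (n , u)) (r (n , w)) (n , w)
                 (RkGe-⊆ₐ (r (n , u)) w u w⊆u (rk≥r (n , u))) (rk≤r (n , w))

  Candidate : Approx T → Node → Set
  Candidate a (k , q) = Σ (App T k) λ B → B ⊴ proj₂ a × q ∈ pts B × ¬ SplitsAbove (k , B) (r a) q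

  least-candidate : ∀ a → Σ Node λ x → Candidate a x × (∀ y → Candidate a y → x ≤shortlex y)
  least-candidate a@(n , A) =
    let (p , p∈ , unsplit) = RkLe⇒unsplit (r a) a (rk≤r a)
    in shortlex-least (Candidate a) ((n , p) , A , ⊴-refl A , p∈ , unsplit)

  anchor : Approx T → Node
  anchor a = proj₁ (least-candidate a)

  anchor-candidate : ∀ a → Candidate a (anchor a)
  anchor-candidate a = proj₁ (proj₂ (least-candidate a))

  anchor-least : ∀ a y → Candidate a y → anchor a ≤shortlex y
  anchor-least a = proj₂ (proj₂ (least-candidate a))

  anchor-level : ∀ a → proj₁ (anchor a) ≤ℕ lvl a
  anchor-level a = ⊴-level (proj₁ (proj₂ (anchor-candidate a)))

  candidate-extends-uniquely : ∀ a {x} → Candidate a x →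
                               ∀ {t t'} → t ∈ pts (proj₂ a) → t' ∈ pts (proj₂ a) →
                               proj₂ x ⊑ t → proj₂ x ⊑ t' → t ≡ t'
  candidate-extends-uniquely a@(n , A) (B , B⊴A , q∈B , unsplit) t∈ t'∈ q⊑t q⊑t'
    with m≤n⇒m<n∨m≡n (⊴-level B⊴A)
  ... | inj₁ k<n = decidable-stable (dec _) λ t≢t' →
          -- otherwise q splits in A itself, which extends B and has rank r a
          unsplit (a , ⊴⇒≺ B⊴A k<n , rk≥r a , (_ , _ , t∈ , t'∈ , t≢t' , q⊑t , q⊑t'))
  ... | inj₂ refl = trans (sym (⊑⇒≡ q⊑t)) (⊑⇒≡ q⊑t')

  choice : ∀ a → Σ (Seq (lvl a)) λ t → t ∈ pts (proj₂ a) × proj₂ (anchor a) ⊑ t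
  choice a = let (_ , B⊴A , q∈B , _) = anchor-candidate a in up B⊴A q∈B

  c : (a : Approx T) → Seq (lvl a)
  c a = proj₁ (choice a)

  c∈ : ∀ a → c a ∈ pts (proj₂ a)
  c∈ a = proj₁ (proj₂ (choice a))

  anchor⊑c : ∀ a → proj₂ (anchor a) ⊑ c a
  anchor⊑c a = proj₂ (proj₂ (choice a))

  r-drops : ∀ {a a'} → a ≺ a' → Splits (c a) a' → r a' <o r a
  r-drops {a} {a'} a≺a' (t₁ , t₂ , t₁∈ , t₂∈ , t₁≢t₂ , c⊑t₁ , c⊑t₂) =
    let (B , B⊴A , _ , unsplit) = anchor-candidate a
        q⊑c = anchor⊑c a
    in RkGe∧¬RkGe⇒<o (r a') (r a) a' (rk≥r a') λ rk'≥r →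
         unsplit (a' , ⊴-≺-trans {a = a'} B⊴A a≺a' , rk'≥r ,
                  (t₁ , t₂ , t₁∈ , t₂∈ , t₁≢t₂ , ⊑-trans q⊑c c⊑t₁ , ⊑-trans q⊑c c⊑t₂))

  module _ {a a'} (a≺a' : a ≺ a') (r≤r' : r a ≤o r a') (r'≤r : r a' ≤o r a) where

    A⊴A' : proj₂ a ⊴ proj₂ a'
    A⊴A' = ≺⇒⊴ a≺a'

    candidate-forward : ∀ {x} → Candidate a x → Candidate a' x
    candidate-forward (B , B⊴A , q∈B , unsplit) =
      B , ⊴-trans B⊴A A⊴A' , q∈B ,
      λ (b , B≺b , rk≥r' , split) → unsplit (b , B≺b , RkGe-≤o (r a) (r a') b r≤r' rk≥r' , split)

    candidate-backward : ∀ {x} → proj₁ x ≤ℕ lvl a → Candidate a' x → Candidate a x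
    candidate-backward k≤n (B , B⊴A' , q∈B , unsplit) =
      B , ⊴-linear B⊴A' A⊴A' k≤n , q∈B ,
      λ (b , B≺b , rk≥r , split) → unsplit (b , B≺b , RkGe-≤o (r a') (r a) b r'≤r rk≥r , split)

    anchor-≡ : anchor a ≡ anchor a'
    anchor-≡ = ≤shortlex-antisym anchor≤anchor' anchor'≤anchor
      where
      anchor'≤anchor : anchor a' ≤shortlex anchor a
      anchor'≤anchor = anchor-least a' (anchor a) (candidate-forward (anchor-candidate a))
      anchor≤anchor' : anchor a ≤shortlex anchor a'
      anchor≤anchor' = anchor-least a (anchor a') (candidate-backward
        (≤-trans (≤shortlex⇒≤ anchor'≤anchor) (anchor-level a)) (anchor-candidate a'))

    c-coherent : c a ⊑ c a'
    c-coherent =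
      let (s , s∈ , s⊑c') = down A⊴A' (c∈ a')
          q⊑c' = subst (λ x → proj₂ x ⊑ c a') (sym anchor-≡) (anchor⊑c a')
          q⊑s = ⊑-linear q⊑c' s⊑c' (anchor-level a)
          s≡c = candidate-extends-uniquely a (anchor-candidate a) s∈ (c∈ a) q⊑s (anchor⊑c a)
      in subst (_⊑ c a') s≡c s⊑c'

  ranked : BasicColoringTree T → IsRanked γ T r c
  ranked basic = record
    { basic  = basic
    ; rBound = r<γ
    ; cIn    = c∈
    ; U1a    = r-antitone
    ; U1b    = r-drops
    ; U2     = λ a≺a' (r≤r' , r'≤r) _ → c-coherent a≺a' r≤r' r'≤r
    ; U3     = λ w u w⊆u col≡ → r-⊆ₐ w u (w⊆u , col≡)
    }

claim5p4 : (γ : Ord) →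
    ((T : Triples) (r : Approx T → Ord) (c : (a : Approx T) → Seq (lvl a)) →
       IsRanked γ T r c → (a : Approx T) → RkLe T a (r a))
    ×
    (((P : Set) → Dec P) →
     (T : Triples) → BasicColoringTree T → TreeRkLe T γ →
       Σ (Approx T → Ord) λ r → Σ ((a : Approx T) → Seq (lvl a)) λ c → IsRanked γ T r c)
claim5p4 γ =
  (λ T r c ranked → RankBound.rk≤r r c (IsRanked.cIn ranked) (IsRanked.U1b ranked)) ,
  (λ dec T basic rk<γ → let open Construction dec rk<γ in r , c , ranked basic)
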